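{- (Introduction property.) Let $t$ be a closed irreducible proof-term of $A$ in the $\mathcal{L}^{\mathcal S}_2$-calculus. Then: $A$ is not a proposition variable $X$; if $A=\mathbf 1$ then $t=a.\star$ for some $a\in\mathcal S$; if $A=B\multimap C$ then $t=\lambda x^B.u$; if $A=B\otimes C$ then $t$ has the form $u\otimes v$, $u\boxplus v$, or $a\bullet u$; if $A=\top$ then $t=\langle\rangle$; $A$ is not $\mathbf 0$; if $A=B\& C$ then $t=\langle u,v\rangle$; if $A=B\oplus C$ then $t$ has the form $\mathrm{inl}(u)$, $\mathrm{inr}(u)$, $u\boxplus v$, or $a\bullet u$; if $A=\,!B$ then $t=\,!u$; if $A=\forall X.B$ then $t=\Lambda X.u$.
   Context: Let $\mathcal S$ be a semiring. Propositions (modulo $\alpha$): $A ::= X \mid \mathbf 1 \mid A\multimap A\mid A\otimes A\mid \top\mid \mathbf 0\mid A\,\&\,A\mid A\oplus A\mid\, !A\mid \forall X.A$. Proof-terms (modulo $\alpha$; $a\in\mathcal S$): $t ::= x \mid t\boxplus u\mid a\bullet t\mid a.\star\mid \delta_{\mathbf 1}(t,u)\mid \lambda x^A.t\mid t\,u\mid t\otimes u\mid \delta_\otimes(t,x^Ay^B.u)\mid\langle\rangle\mid \delta_{\mathbf 0}(t) \mid \langle t,u\rangle\mid \delta^1_\&(t,x^A.u)\mid\delta^2_\&(t,x^B.u)\mid \mathrm{inl}(t)\mid\mathrm{inr}(t)\mid\delta_\oplus(t,x^A.u,y^B.v)\mid\, !t\mid\delta_!(t,x^A.u)\mid\Lambda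 X.t\mid t\,A$ ($\boxplus$: proof-term sum). Typing rules for $\Xi;\Gamma\vdash t:A$ ($\Xi$ non-linear, $\Gamma$ linear; $\Gamma,\Delta$ disjoint union): $\Xi;x^A\vdash x:A$; $\Xi,x^A;\varnothing\vdash x:A$; from $\Xi;\Gamma\vdash t:A$ and $\Xi;\Gamma\vdash u:A$ infer $\Xi;\Gamma\vdash t\boxplus u:A$; from $\Xi;\Gamma\vdash t:A$ infer $\Xi;\Gamma\vdash a\bullet t:A$; $\Xi;\varnothing\vdash a.\star:\mathbf 1$; from $\Xi;\Gamma\vdash t:\mathbf 1$, $\Xi;\Delta\vdash u:A$ infer $\Xi;\Gamma,\Delta\vdash \delta_{\mathbf 1}(t,u):A$; from $\Xi;\Gamma,x^A\vdash t:B$ infer $\Xi;\Gamma\vdash \lambda x^A.t:A\multimap B$; from $\Xi;\Gamma\vdash t:A\multimap B$, $\Xi;\Delta\vdash u:A$ infer $\Xi;\Gamma,\Delta\vdash t\,u:B$; from $\Xi;\Gamma\vdash t:A$, $\Xi;\Delta\vdash u:B$ infer $\Xi;\Gamma,\Delta\vdash t\otimes u:A\otimes B$; from $\Xi;\Gamma\vdash t:A\otimes B$, $\Xi;\Delta,x^A,y^B\vdash u:C$ infer $\Xi;\Gamma,\Delta\vdash\delta_\otimes(t,x^Ay^B.u):C$; $\Xi;\Gamma\vdash\langle\rangle:\top$; from $\Xi;\Gamma\vdash t:\mathbf 0$ infer $\Xi;\Gamma,\Delta\vdash\delta_{\mathbf 0}(t):C$; from $\Xi;\Gamma\vdash t:A$,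 $\Xi;\Gamma\vdash u:B$ infer $\Xi;\Gamma\vdash\langle t,u\rangle:A\&B$; from $\Xi;\Gamma\vdash t:A\&B$, $\Xi;\Delta,x^A\vdash u:C$ infer $\Xi;\Gamma,\Delta\vdash\delta^1_\&(t,x^A.u):C$; from $\Xi;\Gamma\vdash t:A\&B$, $\Xi;\Delta,x^B\vdash u:C$ infer $\Xi;\Gamma,\Delta\vdash\delta^2_\&(t,x^B.u):C$; from $\Xi;\Gamma\vdash t:A$ infer $\Xi;\Gamma\vdash\mathrm{inl}(t):A\oplus B$; from $\Xi;\Gamma\vdash t:B$ infer $\Xi;\Gamma\vdash\mathrm{inr}(t):A\oplus B$; from $\Xi;\Gamma\vdash t:A\oplus B$, $\Xi;\Delta,x^A\vdash u:C$, $\Xi;\Delta,y^B\vdash v:C$ infer $\Xi;\Gamma,\Delta\vdash\delta_\oplus(t,x^A.u,y^B.v):C$; from $\Xi;\varnothing\vdash t:A$ infer $\Xi;\varnothing\vdash\, !t:\,!A$; from $\Xi;\Gamma\vdash t:\,!A$, $\Xi,x^A;\Delta\vdash u:B$ infer $\Xi;\Gamma,\Delta\vdash\delta_!(t,x^A.u):B$; from $\Xi;\Gamma\vdash t:A$ with $X\notin FV(\Xi,\Gamma)$ infer $\Xi;\Gamma\vdash\Lambda X.t:\forall X.A$; from $\Xi;\Gamma\vdash t:\forall X.B$ infer $\Xi;\Gamma\vdash t\,A:(A/X)B$. Reduction $\to$ is the closure under all proof-term contexts of: $\delta_{\mathbf 1}(a.\star,t)\to a\bullet t$; $(\lambda x^A.t)\,u\to(u/x)t$;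 $\delta_\otimes(u\otimes v,x^Ay^B.w)\to(u/x,v/y)w$; $\delta^i_\&(\langle t_1,t_2\rangle,x.v)\to(t_i/x)v$; $\delta_\oplus(\mathrm{inl}(t),x^A.v,y^B.w)\to(t/x)v$; $\delta_\oplus(\mathrm{inr}(u),x^A.v,y^B.w)\to(u/y)w$; $\delta_!(!t,x^A.u)\to(t/x)u$; $(\Lambda X.t)\,A\to(A/X)t$; $a.\star\boxplus b.\star\to(a+b).\star$; $(\lambda x^A.t)\boxplus(\lambda x^A.u)\to\lambda x^A.(t\boxplus u)$; $\delta_\otimes(t\boxplus u,x^Ay^B.v)\to\delta_\otimes(t,x^Ay^B.v)\boxplus\delta_\otimes(u,x^Ay^B.v)$; $\langle\rangle\boxplus\langle\rangle\to\langle\rangle$; $\langle t,u\rangle\boxplus\langle v,w\rangle\to\langle t\boxplus v,u\boxplus w\rangle$; $\delta_\oplus(t\boxplus u,x^A.v,y^B.w)\to\delta_\oplus(t,x^A.v,y^B.w)\boxplus\delta_\oplus(u,x^A.v,y^B.w)$; $!t\boxplus !u\to !(t\boxplus u)$; $(\Lambda X.t)\boxplus(\Lambda X.u)\to\Lambda X.(t\boxplus u)$; $a\bullet b.\star\to(a\times b).\star$; $a\bullet\lambda x^A.t\to\lambda x^A.a\bullet t$; $\delta_\otimes(a\bullet t,x^Ay^B.v)\to a\bullet\delta_\otimes(t,x^Ay^B.v)$; $a\bullet\langle\rangle\to\langle\rangle$; $a\bullet\langle t,u\rangle\to\langle a\bullet t,a\bullet u\rangle$; $\delta_\oplus(a\bullet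 t,x^A.v,y^B.w)\to a\bullet\delta_\oplus(t,x^A.v,y^B.w)$; $a\bullet !t\to !(a\bullet t)$; $a\bullet\Lambda X.t\to\Lambda X.a\bullet t$. A closed irreducible proof-term of $A$ is a proof-term with no free proof-term variables, to which no reduction rule applies, and which is typable with proposition $A$ by the rules above. -}

module Defs where

-- Syntax of the L^S_2 calculus, with de Bruijn indices (this realises "modulo α").
-- Proposition variables: unscoped de Bruijn indices (ℕ); free proposition variables allowed.
-- Proof-term variables: well-scoped de Bruijn indices (Fin n); closed = Tm 0.

open import Level using (Level)
open import Algebra.Bundles using (Semiring)
open import Data.Nat using (ℕ; zero; suc)
open import Data.Fin using (Fin; zero; suc)
open import Data.Vec using (Vec; []; _∷_; map)
open import Data.Product using (∃; _,_; _×_)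
open import Relation.Nullary using (¬_)

infixr 5 _⊸_
infixr 6 _⊗_ _&_ _⊕_

data Form : Set where
  `_   : ℕ → Form
  1ᶠ   : Form
  _⊸_  : Form → Form → Form
  _⊗_  : Form → Form → Form
  ⊤ᶠ   : Form
  0ᶠ   : Form
  _&_  : Form → Form → Form
  _⊕_  : Form → Form → Form
  !_   : Form → Form
  ∀̇_   : Form → Form              -- ∀X.A  (X is index 0 in the body)

extℕ : (ℕ → ℕ) → ℕ → ℕ
extℕ ρ zero = zero
extℕ ρ (suc n) = suc (ρ n)

renF : (ℕ → ℕ) → Form → Form
renF ρ (` X) = ` (ρ X)
renF ρ 1ᶠ = 1ᶠ
renF ρ (A ⊸ B) = renF ρ A ⊸ renF ρ B
renF ρ (A ⊗ B) = renF ρ A ⊗ renF ρ B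
renF ρ ⊤ᶠ = ⊤ᶠ
renF ρ 0ᶠ = 0ᶠ
renF ρ (A & B) = renF ρ A & renF ρ B
renF ρ (A ⊕ B) = renF ρ A ⊕ renF ρ B
renF ρ (! A) = ! renF ρ A
renF ρ (∀̇ A) = ∀̇ renF (extℕ ρ) A

extsF : (ℕ → Form) → ℕ → Form
extsF σ zero = ` zero
extsF σ (suc n) = renF suc (σ n)

subF : (ℕ → Form) → Form → Form
subF σ (` X) = σ X
subF σ 1ᶠ = 1ᶠ
subF σ (A ⊸ B) = subF σ A ⊸ subF σ B
subF σ (A ⊗ B) = subF σ A ⊗ subF σ B
subF σ ⊤ᶠ = ⊤ᶠ
subF σ 0ᶠ = 0ᶠ
subF σ (A & B) = subF σ A & subF σ B
subF σ (A ⊕ B) = subF σ A ⊕ subF σ B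
subF σ (! A) = ! subF σ A
subF σ (∀̇ A) = ∀̇ subF (extsF σ) A

singleF : Form → ℕ → Form
singleF A zero = A
singleF A (suc n) = ` n

-- (A/X)B, where B is the body of ∀X.B
_[_]ᶠ : Form → Form → Form
B [ A ]ᶠ = subF (singleF A) B

module L2 {c ℓ : Level} (S : Semiring c ℓ) where

  open Semiring S using (Carrier; _+_; _*_)

  infixl 6 _⊞_
  infixr 7 _⊗ₜ_
  infixr 8 _•_
  infixl 9 _·_ _·ᶠ_

  data Tm (n : ℕ) : Set c where
    var    : Fin n → Tm n
    _⊞_    : Tm n → Tm n → Tm n
    _•_    : Carrier → Tm n → Tm n
    _·⋆    : Carrier → Tm n
    δ𝟏     : Tm n → Tm n → Tm n
    ƛ      : Form → Tm (suc n) → Tm n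
    _·_    : Tm n → Tm n → Tm n
    _⊗ₜ_   : Tm n → Tm n → Tm n
    δ⊗     : Tm n → Form → Form → Tm (suc (suc n)) → Tm n -- δ⊗(t, x^A y^B. u): y = index 0, x = index 1
    ⟨⟩     : Tm n
    δ𝟎     : Tm n → Tm n
    ⟨_,_⟩  : Tm n → Tm n → Tm n
    δ&₁    : Tm n → Form → Tm (suc n) → Tm n
    δ&₂    : Tm n → Form → Tm (suc n) → Tm n
    inl    : Tm n → Tm n
    inr    : Tm n → Tm n
    δ⊕     : Tm n → Form → Tm (suc n) → Form → Tm (suc n) → Tm n
    !ₜ_    : Tm n → Tm n
    δ!     : Tm n → Form → Tm (suc n) → Tm n
    Λ_     : Tm n → Tm n                                  -- ΛX.t (X is index 0 in t)
    _·ᶠ_   : Tm n → Form → Tm n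

  private variable n m : ℕ

  tyRen : (ℕ → ℕ) → Tm n → Tm n
  tyRen ρ (var i) = var i
  tyRen ρ (t ⊞ u) = tyRen ρ t ⊞ tyRen ρ u
  tyRen ρ (a • t) = a • tyRen ρ t
  tyRen ρ (a ·⋆) = a ·⋆
  tyRen ρ (δ𝟏 t u) = δ𝟏 (tyRen ρ t) (tyRen ρ u)
  tyRen ρ (ƛ A t) = ƛ (renF ρ A) (tyRen ρ t)
  tyRen ρ (t · u) = tyRen ρ t · tyRen ρ u
  tyRen ρ (t ⊗ₜ u) = tyRen ρ t ⊗ₜ tyRen ρ u
  tyRen ρ (δ⊗ t A B u) = δ⊗ (tyRen ρ t) (renF ρ A) (renF ρ B) (tyRen ρ u)
  tyRen ρ ⟨⟩ = ⟨⟩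
  tyRen ρ (δ𝟎 t) = δ𝟎 (tyRen ρ t)
  tyRen ρ ⟨ t , u ⟩ = ⟨ tyRen ρ t , tyRen ρ u ⟩
  tyRen ρ (δ&₁ t A u) = δ&₁ (tyRen ρ t) (renF ρ A) (tyRen ρ u)
  tyRen ρ (δ&₂ t A u) = δ&₂ (tyRen ρ t) (renF ρ A) (tyRen ρ u)
  tyRen ρ (inl t) = inl (tyRen ρ t)
  tyRen ρ (inr t) = inr (tyRen ρ t)
  tyRen ρ (δ⊕ t A u B v) = δ⊕ (tyRen ρ t) (renF ρ A) (tyRen ρ u) (renF ρ B) (tyRen ρ v)
  tyRen ρ (!ₜ t) = !ₜ tyRen ρ t
  tyRen ρ (δ! t A u) = δ! (tyRen ρ t) (renF ρ A) (tyRen ρ u)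
  tyRen ρ (Λ t) = Λ tyRen (extℕ ρ) t
  tyRen ρ (t ·ᶠ A) = tyRen ρ t ·ᶠ renF ρ A

  tySub : (ℕ → Form) → Tm n → Tm n
  tySub σ (var i) = var i
  tySub σ (t ⊞ u) = tySub σ t ⊞ tySub σ u
  tySub σ (a • t) = a • tySub σ t
  tySub σ (a ·⋆) = a ·⋆
  tySub σ (δ𝟏 t u) = δ𝟏 (tySub σ t) (tySub σ u)
  tySub σ (ƛ A t) = ƛ (subF σ A) (tySub σ t)
  tySub σ (t · u) = tySub σ t · tySub σ u
  tySub σ (t ⊗ₜ u) = tySub σ t ⊗ₜ tySub σ u
  tySub σ (δ⊗ t A B u) = δ⊗ (tySub σ t) (subF σ A) (subF σ B) (tySub σ u)
  tySub σ ⟨⟩ = ⟨⟩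
  tySub σ (δ𝟎 t) = δ𝟎 (tySub σ t)
  tySub σ ⟨ t , u ⟩ = ⟨ tySub σ t , tySub σ u ⟩
  tySub σ (δ&₁ t A u) = δ&₁ (tySub σ t) (subF σ A) (tySub σ u)
  tySub σ (δ&₂ t A u) = δ&₂ (tySub σ t) (subF σ A) (tySub σ u)
  tySub σ (inl t) = inl (tySub σ t)
  tySub σ (inr t) = inr (tySub σ t)
  tySub σ (δ⊕ t A u B v) = δ⊕ (tySub σ t) (subF σ A) (tySub σ u) (subF σ B) (tySub σ v)
  tySub σ (!ₜ t) = !ₜ tySub σ t
  tySub σ (δ! t A u) = δ! (tySub σ t) (subF σ A) (tySub σ u)
  tySub σ (Λ t) = Λ tySub (extsF σ) t
  tySub σ (t ·ᶠ A) = tySub σ t ·ᶠ subF σ A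

  extR : (Fin n → Fin m) → Fin (suc n) → Fin (suc m)
  extR ρ zero = zero
  extR ρ (suc i) = suc (ρ i)

  ren : (Fin n → Fin m) → Tm n → Tm m
  ren ρ (var i) = var (ρ i)
  ren ρ (t ⊞ u) = ren ρ t ⊞ ren ρ u
  ren ρ (a • t) = a • ren ρ t
  ren ρ (a ·⋆) = a ·⋆
  ren ρ (δ𝟏 t u) = δ𝟏 (ren ρ t) (ren ρ u)
  ren ρ (ƛ A t) = ƛ A (ren (extR ρ) t)
  ren ρ (t · u) = ren ρ t · ren ρ u
  ren ρ (t ⊗ₜ u) = ren ρ t ⊗ₜ ren ρ u
  ren ρ (δ⊗ t A B u) = δ⊗ (ren ρ t) A B (ren (extR (extR ρ)) u)
  ren ρ ⟨⟩ = ⟨⟩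
  ren ρ (δ𝟎 t) = δ𝟎 (ren ρ t)
  ren ρ ⟨ t , u ⟩ = ⟨ ren ρ t , ren ρ u ⟩
  ren ρ (δ&₁ t A u) = δ&₁ (ren ρ t) A (ren (extR ρ) u)
  ren ρ (δ&₂ t A u) = δ&₂ (ren ρ t) A (ren (extR ρ) u)
  ren ρ (inl t) = inl (ren ρ t)
  ren ρ (inr t) = inr (ren ρ t)
  ren ρ (δ⊕ t A u B v) = δ⊕ (ren ρ t) A (ren (extR ρ) u) B (ren (extR ρ) v)
  ren ρ (!ₜ t) = !ₜ ren ρ t
  ren ρ (δ! t A u) = δ! (ren ρ t) A (ren (extR ρ) u)
  ren ρ (Λ t) = Λ ren ρ t
  ren ρ (t ·ᶠ A) = ren ρ t ·ᶠ A

  exts : (Fin n → Tm m) → Fin (suc n) → Tm (suc m)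
  exts σ zero = var zero
  exts σ (suc i) = ren suc (σ i)

  -- under ΛX the substituted terms have their free proposition variables shifted
  extsΛ : (Fin n → Tm m) → Fin n → Tm m
  extsΛ σ i = tyRen suc (σ i)

  sub : (Fin n → Tm m) → Tm n → Tm m
  sub σ (var i) = σ i
  sub σ (t ⊞ u) = sub σ t ⊞ sub σ u
  sub σ (a • t) = a • sub σ t
  sub σ (a ·⋆) = a ·⋆
  sub σ (δ𝟏 t u) = δ𝟏 (sub σ t) (sub σ u)
  sub σ (ƛ A t) = ƛ A (sub (exts σ) t)
  sub σ (t · u) = sub σ t · sub σ u
  sub σ (t ⊗ₜ u) = sub σ t ⊗ₜ sub σ u
  sub σ (δ⊗ t A B u) = δ⊗ (sub σ t) A B (sub (exts (exts σ)) u)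
  sub σ ⟨⟩ = ⟨⟩
  sub σ (δ𝟎 t) = δ𝟎 (sub σ t)
  sub σ ⟨ t , u ⟩ = ⟨ sub σ t , sub σ u ⟩
  sub σ (δ&₁ t A u) = δ&₁ (sub σ t) A (sub (exts σ) u)
  sub σ (δ&₂ t A u) = δ&₂ (sub σ t) A (sub (exts σ) u)
  sub σ (inl t) = inl (sub σ t)
  sub σ (inr t) = inr (sub σ t)
  sub σ (δ⊕ t A u B v) = δ⊕ (sub σ t) A (sub (exts σ) u) B (sub (exts σ) v)
  sub σ (!ₜ t) = !ₜ sub σ t
  sub σ (δ! t A u) = δ! (sub σ t) A (sub (exts σ) u)
  sub σ (Λ t) = Λ sub (extsΛ σ) t
  sub σ (t ·ᶠ A) = sub σ t ·ᶠ A

  single : Tm n → Fin (suc n) → Tm n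
  single u zero = u
  single u (suc i) = var i

  double : Tm n → Tm n → Fin (suc (suc n)) → Tm n
  double u v zero = v
  double u v (suc zero) = u
  double u v (suc (suc i)) = var i

  _[_] : Tm (suc n) → Tm n → Tm n
  t [ u ] = sub (single u) t

  -- (u/x, v/y)w   (x = index 1, y = index 0)
  _[_,_]₂ : Tm (suc (suc n)) → Tm n → Tm n → Tm n
  w [ u , v ]₂ = sub (double u v) w

  _[_]ᵀ : Tm n → Form → Tm n
  t [ A ]ᵀ = tySub (singleF A) t

  infix 3 _⟶_

  data _⟶_ {n : ℕ} : Tm n → Tm n → Set c where
    β𝟏   : ∀ {a t} → δ𝟏 (a ·⋆) t ⟶ a • t
    β⊸   : ∀ {A t u} → ƛ A t · u ⟶ t [ u ]
    β⊗   : ∀ {A B u v w} → δ⊗ (u ⊗ₜ v) A B w ⟶ w [ u , v ]₂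
    β&₁  : ∀ {t₁ t₂ A v} → δ&₁ ⟨ t₁ , t₂ ⟩ A v ⟶ v [ t₁ ]
    β&₂  : ∀ {t₁ t₂ A v} → δ&₂ ⟨ t₁ , t₂ ⟩ A v ⟶ v [ t₂ ]
    β⊕₁  : ∀ {t A v B w} → δ⊕ (inl t) A v B w ⟶ v [ t ]
    β⊕₂  : ∀ {u A v B w} → δ⊕ (inr u) A v B w ⟶ w [ u ]
    β!   : ∀ {t A u} → δ! (!ₜ t) A u ⟶ u [ t ]
    β∀   : ∀ {t A} → (Λ t) ·ᶠ A ⟶ t [ A ]ᵀ
    ⊞𝟏   : ∀ {a b} → a ·⋆ ⊞ b ·⋆ ⟶ (a + b) ·⋆
    ⊞⊸   : ∀ {A t u} → ƛ A t ⊞ ƛ A u ⟶ ƛ A (t ⊞ u)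
    ⊞⊗   : ∀ {t u A B v} → δ⊗ (t ⊞ u) A B v ⟶ δ⊗ t A B v ⊞ δ⊗ u A B v
    ⊞⊤   : ⟨⟩ ⊞ ⟨⟩ ⟶ ⟨⟩
    ⊞&   : ∀ {t u v w} → ⟨ t , u ⟩ ⊞ ⟨ v , w ⟩ ⟶ ⟨ t ⊞ v , u ⊞ w ⟩
    ⊞⊕   : ∀ {t u A v B w} → δ⊕ (t ⊞ u) A v B w ⟶ δ⊕ t A v B w ⊞ δ⊕ u A v B w
    ⊞!   : ∀ {t u} → !ₜ t ⊞ !ₜ u ⟶ !ₜ (t ⊞ u)
    ⊞∀   : ∀ {t u} → (Λ t) ⊞ (Λ u) ⟶ Λ (t ⊞ u)
    •𝟏   : ∀ {a b} → a • (b ·⋆) ⟶ (a * b) ·⋆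
    •⊸   : ∀ {a A t} → a • ƛ A t ⟶ ƛ A (a • t)
    •⊗   : ∀ {a t A B v} → δ⊗ (a • t) A B v ⟶ a • δ⊗ t A B v
    •⊤   : ∀ {a} → a • ⟨⟩ ⟶ ⟨⟩
    •&   : ∀ {a t u} → a • ⟨ t , u ⟩ ⟶ ⟨ a • t , a • u ⟩
    •⊕   : ∀ {a t A v B w} → δ⊕ (a • t) A v B w ⟶ a • δ⊕ t A v B w
    •!   : ∀ {a t} → a • (!ₜ t) ⟶ !ₜ (a • t)
    •∀   : ∀ {a t} → a • (Λ t) ⟶ Λ (a • t)
    ξ⊞ˡ  : ∀ {t t' u} → t ⟶ t' → t ⊞ u ⟶ t' ⊞ u
    ξ⊞ʳ  : ∀ {t u u'} → u ⟶ u' → t ⊞ u ⟶ t ⊞ u'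
    ξ•   : ∀ {a t t'} → t ⟶ t' → a • t ⟶ a • t'
    ξδ𝟏ˡ : ∀ {t t' u} → t ⟶ t' → δ𝟏 t u ⟶ δ𝟏 t' u
    ξδ𝟏ʳ : ∀ {t u u'} → u ⟶ u' → δ𝟏 t u ⟶ δ𝟏 t u'
    ξƛ   : ∀ {A t t'} → _⟶_ {suc n} t t' → ƛ A t ⟶ ƛ A t'
    ξ·ˡ  : ∀ {t t' u} → t ⟶ t' → t · u ⟶ t' · u
    ξ·ʳ  : ∀ {t u u'} → u ⟶ u' → t · u ⟶ t · u'
    ξ⊗ˡ  : ∀ {t t' u} → t ⟶ t' → t ⊗ₜ u ⟶ t' ⊗ₜ u
    ξ⊗ʳ  : ∀ {t u u'} → u ⟶ u' → t ⊗ₜ u ⟶ t ⊗ₜ u'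
    ξδ⊗ˡ : ∀ {t t' A B u} → t ⟶ t' → δ⊗ t A B u ⟶ δ⊗ t' A B u
    ξδ⊗ʳ : ∀ {t A B u u'} → _⟶_ {suc (suc n)} u u' → δ⊗ t A B u ⟶ δ⊗ t A B u'
    ξδ𝟎  : ∀ {t t'} → t ⟶ t' → δ𝟎 t ⟶ δ𝟎 t'
    ξ⟨⟩ˡ : ∀ {t t' u} → t ⟶ t' → ⟨ t , u ⟩ ⟶ ⟨ t' , u ⟩
    ξ⟨⟩ʳ : ∀ {t u u'} → u ⟶ u' → ⟨ t , u ⟩ ⟶ ⟨ t , u' ⟩
    ξδ&₁ˡ : ∀ {t t' A u} → t ⟶ t' → δ&₁ t A u ⟶ δ&₁ t' A u
    ξδ&₁ʳ : ∀ {t A u u'} → _⟶_ {suc n} u u' → δ&₁ t A u ⟶ δ&₁ t A u'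
    ξδ&₂ˡ : ∀ {t t' A u} → t ⟶ t' → δ&₂ t A u ⟶ δ&₂ t' A u
    ξδ&₂ʳ : ∀ {t A u u'} → _⟶_ {suc n} u u' → δ&₂ t A u ⟶ δ&₂ t A u'
    ξinl : ∀ {t t'} → t ⟶ t' → inl t ⟶ inl t'
    ξinr : ∀ {t t'} → t ⟶ t' → inr t ⟶ inr t'
    ξδ⊕₀ : ∀ {t t' A u B v} → t ⟶ t' → δ⊕ t A u B v ⟶ δ⊕ t' A u B v
    ξδ⊕₁ : ∀ {t A u u' B v} → _⟶_ {suc n} u u' → δ⊕ t A u B v ⟶ δ⊕ t A u' B v
    ξδ⊕₂ : ∀ {t A u B v v'} → _⟶_ {suc n} v v' → δ⊕ t A u B v ⟶ δ⊕ t A u B v'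
    ξ!   : ∀ {t t'} → t ⟶ t' → !ₜ t ⟶ !ₜ t'
    ξδ!ˡ : ∀ {t t' A u} → t ⟶ t' → δ! t A u ⟶ δ! t' A u
    ξδ!ʳ : ∀ {t A u u'} → _⟶_ {suc n} u u' → δ! t A u ⟶ δ! t A u'
    ξΛ   : ∀ {t t'} → t ⟶ t' → Λ t ⟶ Λ t'
    ξ·ᶠ  : ∀ {t t' A} → t ⟶ t' → t ·ᶠ A ⟶ t' ·ᶠ A

  Irreducible : Tm n → Set c
  Irreducible t = ¬ ∃ λ t' → t ⟶ t'

  -- A context is one vector of slots, one per de Bruijn proof-term
  -- variable; a slot is a linear hypothesis (in Γ), a non-linear hypothesis
  -- (in Ξ), or "absent" (a linear variable belonging to the other part of a split).

  data Slot : Set where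
    lin   : Form → Slot
    nl    : Form → Slot
    absent : Slot

  Ctx : ℕ → Set
  Ctx = Vec Slot

  data NoLin : Slot → Set where
    nl-nolin     : ∀ {A} → NoLin (nl A)
    absent-nolin : NoLin absent

  data LinEmpty : Ctx n → Set where
    []  : LinEmpty []
    _∷_ : ∀ {s Γ} → NoLin s → LinEmpty {n} Γ → LinEmpty (s ∷ Γ)

  -- disjoint union of linear parts, Ξ shared:  Split Γ Γ₁ Γ₂ ≈ "Ξ;Γ = Ξ;Γ₁,Γ₂"
  data Split : Ctx n → Ctx n → Ctx n → Set where
    []    : Split [] [] []
    linˡ  : ∀ {A Γ Γ₁ Γ₂} → Split {n} Γ Γ₁ Γ₂ → Split (lin A ∷ Γ) (lin A ∷ Γ₁) (absent ∷ Γ₂)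
    linʳ  : ∀ {A Γ Γ₁ Γ₂} → Split {n} Γ Γ₁ Γ₂ → Split (lin A ∷ Γ) (absent ∷ Γ₁) (lin A ∷ Γ₂)
    nl    : ∀ {A Γ Γ₁ Γ₂} → Split {n} Γ Γ₁ Γ₂ → Split (nl A ∷ Γ) (nl A ∷ Γ₁) (nl A ∷ Γ₂)
    absent : ∀ {Γ Γ₁ Γ₂} → Split {n} Γ Γ₁ Γ₂ → Split (absent ∷ Γ) (absent ∷ Γ₁) (absent ∷ Γ₂)

  -- Ξ;x^A ⊢ x : A   (the only linear hypothesis is x)
  data LinVar : Ctx n → Fin n → Form → Set where
    here  : ∀ {A Γ} → LinEmpty {n} Γ → LinVar (lin A ∷ Γ) zero A
    there : ∀ {s Γ i A} → NoLin s → LinVar {n} Γ i A → LinVar (s ∷ Γ) (suc i) A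

  -- Ξ,x^A;∅ ⊢ x : A
  data NlVar : Ctx n → Fin n → Form → Set where
    here  : ∀ {A Γ} → LinEmpty {n} Γ → NlVar (nl A ∷ Γ) zero A
    there : ∀ {s Γ i A} → NoLin s → NlVar {n} Γ i A → NlVar (s ∷ Γ) (suc i) A

  -- shifting the free proposition variables of the context (entering ΛX;
  -- this realises the side condition X ∉ FV(Ξ,Γ))
  shiftSlot : Slot → Slot
  shiftSlot (lin A) = lin (renF suc A)
  shiftSlot (nl A) = nl (renF suc A)
  shiftSlot absent = absent

  infix 2 _⊢_∶_

  data _⊢_∶_ {n : ℕ} : Ctx n → Tm n → Form → Set c where
    ax-lin : ∀ {Γ i A} → LinVar Γ i A → Γ ⊢ var i ∶ A
    ax-nl  : ∀ {Γ i A} → NlVar Γ i A → Γ ⊢ var i ∶ A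
    sum    : ∀ {Γ t u A} → Γ ⊢ t ∶ A → Γ ⊢ u ∶ A → Γ ⊢ t ⊞ u ∶ A
    prod   : ∀ {Γ t A a} → Γ ⊢ t ∶ A → Γ ⊢ a • t ∶ A
    𝟏i     : ∀ {Γ a} → LinEmpty Γ → Γ ⊢ a ·⋆ ∶ 1ᶠ
    𝟏e     : ∀ {Γ Γ₁ Γ₂ t u A} → Split Γ Γ₁ Γ₂ → Γ₁ ⊢ t ∶ 1ᶠ → Γ₂ ⊢ u ∶ A → Γ ⊢ δ𝟏 t u ∶ A
    ⊸i     : ∀ {Γ A B t} → _⊢_∶_ {suc n} (lin A ∷ Γ) t B → Γ ⊢ ƛ A t ∶ A ⊸ B
    ⊸e     : ∀ {Γ Γ₁ Γ₂ t u A B} → Split Γ Γ₁ Γ₂ → Γ₁ ⊢ t ∶ A ⊸ B → Γ₂ ⊢ u ∶ A → Γ ⊢ t · u ∶ B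
    ⊗i     : ∀ {Γ Γ₁ Γ₂ t u A B} → Split Γ Γ₁ Γ₂ → Γ₁ ⊢ t ∶ A → Γ₂ ⊢ u ∶ B → Γ ⊢ t ⊗ₜ u ∶ A ⊗ B
    ⊗e     : ∀ {Γ Γ₁ Γ₂ t u A B C} → Split Γ Γ₁ Γ₂ → Γ₁ ⊢ t ∶ A ⊗ B →
             _⊢_∶_ {suc (suc n)} (lin B ∷ lin A ∷ Γ₂) u C → Γ ⊢ δ⊗ t A B u ∶ C
    ⊤i     : ∀ {Γ} → Γ ⊢ ⟨⟩ ∶ ⊤ᶠ
    𝟎e     : ∀ {Γ Γ₁ Γ₂ t C} → Split Γ Γ₁ Γ₂ → Γ₁ ⊢ t ∶ 0ᶠ → Γ ⊢ δ𝟎 t ∶ C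
    &i     : ∀ {Γ t u A B} → Γ ⊢ t ∶ A → Γ ⊢ u ∶ B → Γ ⊢ ⟨ t , u ⟩ ∶ A & B
    &e₁    : ∀ {Γ Γ₁ Γ₂ t u A B C} → Split Γ Γ₁ Γ₂ → Γ₁ ⊢ t ∶ A & B →
             _⊢_∶_ {suc n} (lin A ∷ Γ₂) u C → Γ ⊢ δ&₁ t A u ∶ C
    &e₂    : ∀ {Γ Γ₁ Γ₂ t u A B C} → Split Γ Γ₁ Γ₂ → Γ₁ ⊢ t ∶ A & B →
             _⊢_∶_ {suc n} (lin B ∷ Γ₂) u C → Γ ⊢ δ&₂ t B u ∶ C
    ⊕i₁    : ∀ {Γ t A B} → Γ ⊢ t ∶ A → Γ ⊢ inl t ∶ A ⊕ B
    ⊕i₂    : ∀ {Γ t A B} → Γ ⊢ t ∶ B → Γ ⊢ inr t ∶ A ⊕ B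
    ⊕e     : ∀ {Γ Γ₁ Γ₂ t u v A B C} → Split Γ Γ₁ Γ₂ → Γ₁ ⊢ t ∶ A ⊕ B →
             _⊢_∶_ {suc n} (lin A ∷ Γ₂) u C → _⊢_∶_ {suc n} (lin B ∷ Γ₂) v C →
             Γ ⊢ δ⊕ t A u B v ∶ C
    !i     : ∀ {Γ t A} → LinEmpty Γ → Γ ⊢ t ∶ A → Γ ⊢ !ₜ t ∶ ! A
    !e     : ∀ {Γ Γ₁ Γ₂ t u A B} → Split Γ Γ₁ Γ₂ → Γ₁ ⊢ t ∶ ! A →
             _⊢_∶_ {suc n} (nl A ∷ Γ₂) u B → Γ ⊢ δ! t A u ∶ B
    ∀i     : ∀ {Γ t A} → map shiftSlot Γ ⊢ t ∶ A → Γ ⊢ Λ t ∶ ∀̇ A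
    ∀e     : ∀ {Γ t A B} → Γ ⊢ t ∶ ∀̇ B → Γ ⊢ t ·ᶠ A ∶ B [ A ]ᶠ

  ClosedIrreducibleOf : Tm 0 → Form → Set c
  ClosedIrreducibleOf t A = ([] ⊢ t ∶ A) × Irreducible t

{-# OPTIONS --safe #-}
module Submission where

-- A closed term has no variables, so its last rule is an introduction, a sum,
-- a scalar product, or an elimination.  The principal premise of an elimination
-- is again closed and irreducible, so by induction it has the canonical shape
-- of its type; every such shape makes a β-rule or a ⊞/• commutation rule fire,
-- contradicting irreducibility.  For ⊞ and • the same argument shows that they
-- survive only at the types ⊗ and ⊕, the two connectives without commutation
-- rules for introductions.

open import Defs
open import Level using (Level; lower)
open import Algebra.Bundles using (Semiring)
open import Data.Nat using (ℕ)
open import Data.Vec using ([])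
open import Data.Product using (∃; ∃₂; _×_; _,_)
open import Data.Sum using (_⊎_; inj₁; inj₂)
open import Data.Empty using (⊥; ⊥-elim)
open import Relation.Binary.PropositionalEquality using (_≡_; refl)

module CanonicalForms {c ℓ : Level} (S : Semiring c ℓ) where

  open L2 S
  open Semiring S using (Carrier)
  open import Data.Empty.Polymorphic using () renaming (⊥ to ⊥ᶜ)

  Canonical : ∀ {n} → Form → Tm n → Set c
  Canonical (` X)   t = ⊥ᶜ
  Canonical 1ᶠ      t = ∃ λ (a : Carrier) → t ≡ a ·⋆
  Canonical (B ⊸ C) t = ∃ λ u → t ≡ ƛ B u
  Canonical (B ⊗ C) t =
    (∃₂ λ u v → t ≡ u ⊗ₜ v) ⊎ (∃₂ λ u v → t ≡ u ⊞ v) ⊎ (∃₂ λ a u → t ≡ a • u)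
  Canonical ⊤ᶠ      t = t ≡ ⟨⟩
  Canonical 0ᶠ      t = ⊥ᶜ
  Canonical (B & C) t = ∃₂ λ u v → t ≡ ⟨ u , v ⟩
  Canonical (B ⊕ C) t =
    (∃ λ u → t ≡ inl u) ⊎ (∃ λ u → t ≡ inr u)
    ⊎ (∃₂ λ u v → t ≡ u ⊞ v) ⊎ (∃₂ λ a u → t ≡ a • u)
  Canonical (! B)   t = ∃ λ u → t ≡ !ₜ u
  Canonical (∀̇ B)   t = ∃ λ u → t ≡ Λ u

  Irreducible-inside : ∀ {n} {t s : Tm n} {E : Tm n → Tm n} →
    (∀ {t'} → t ⟶ t' → s ⟶ E t') → Irreducible s → Irreducible t
  Irreducible-inside ξ irr (_ , r) = irr (_ , ξ r)

  ⊞-canonical : ∀ {n} A {t u : Tm n} →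
    Canonical A t → Canonical A u → Irreducible (t ⊞ u) → Canonical A (t ⊞ u)
  ⊞-canonical 1ᶠ      (_ , refl) (_ , refl) irr = ⊥-elim (irr (_ , ⊞𝟏))
  ⊞-canonical (B ⊸ C) (_ , refl) (_ , refl) irr = ⊥-elim (irr (_ , ⊞⊸))
  ⊞-canonical (B ⊗ C) _ _ _ = inj₂ (inj₁ (_ , _ , refl))
  ⊞-canonical ⊤ᶠ      refl refl irr = ⊥-elim (irr (_ , ⊞⊤))
  ⊞-canonical (B & C) (_ , _ , refl) (_ , _ , refl) irr = ⊥-elim (irr (_ , ⊞&))
  ⊞-canonical (B ⊕ C) _ _ _ = inj₂ (inj₂ (inj₁ (_ , _ , refl)))
  ⊞-canonical (! B)   (_ , refl) (_ , refl) irr = ⊥-elim (irr (_ , ⊞!))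
  ⊞-canonical (∀̇ B)   (_ , refl) (_ , refl) irr = ⊥-elim (irr (_ , ⊞∀))

  •-canonical : ∀ {n} A {a} {t : Tm n} →
    Canonical A t → Irreducible (a • t) → Canonical A (a • t)
  •-canonical 1ᶠ      (_ , refl) irr = ⊥-elim (irr (_ , •𝟏))
  •-canonical (B ⊸ C) (_ , refl) irr = ⊥-elim (irr (_ , •⊸))
  •-canonical (B ⊗ C) _ _ = inj₂ (inj₂ (_ , _ , refl))
  •-canonical ⊤ᶠ      refl irr = ⊥-elim (irr (_ , •⊤))
  •-canonical (B & C) (_ , _ , refl) irr = ⊥-elim (irr (_ , •&))
  •-canonical (B ⊕ C) _ _ = inj₂ (inj₂ (inj₂ (_ , _ , refl)))
  •-canonical (! B)   (_ , refl) irr = ⊥-elim (irr (_ , •!))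
  •-canonical (∀̇ B)   (_ , refl) irr = ⊥-elim (irr (_ , •∀))

  closed-irreducible-canonical : ∀ {t A} → [] ⊢ t ∶ A → Irreducible t → Canonical A t
  closed-irreducible-canonical (ax-lin ()) _
  closed-irreducible-canonical (ax-nl ()) _
  closed-irreducible-canonical (sum {A = A} d e) irr =
    ⊞-canonical A (closed-irreducible-canonical d (Irreducible-inside ξ⊞ˡ irr))
                  (closed-irreducible-canonical e (Irreducible-inside ξ⊞ʳ irr)) irr
  closed-irreducible-canonical (prod {A = A} d) irr =
    •-canonical A (closed-irreducible-canonical d (Irreducible-inside ξ• irr)) irr
  closed-irreducible-canonical (𝟏i _) _ = _ , refl
  closed-irreducible-canonical (⊸i _) _ = _ , refl
  closed-irreducible-canonical (⊗i [] _ _) _ = inj₁ (_ , _ , refl)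
  closed-irreducible-canonical ⊤i _ = refl
  closed-irreducible-canonical (&i _ _) _ = _ , _ , refl
  closed-irreducible-canonical (⊕i₁ _) _ = inj₁ (_ , refl)
  closed-irreducible-canonical (⊕i₂ _) _ = inj₂ (inj₁ (_ , refl))
  closed-irreducible-canonical (!i _ _) _ = _ , refl
  closed-irreducible-canonical (∀i _) _ = _ , refl
  closed-irreducible-canonical (𝟏e [] d _) irr
    with closed-irreducible-canonical d (Irreducible-inside ξδ𝟏ˡ irr)
  ... | _ , refl = ⊥-elim (irr (_ , β𝟏))
  closed-irreducible-canonical (⊸e [] d _) irr
    with closed-irreducible-canonical d (Irreducible-inside ξ·ˡ irr)
  ... | _ , refl = ⊥-elim (irr (_ , β⊸))
  closed-irreducible-canonical (⊗e [] d _) irr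
    with closed-irreducible-canonical d (Irreducible-inside ξδ⊗ˡ irr)
  ... | inj₁ (_ , _ , refl)        = ⊥-elim (irr (_ , β⊗))
  ... | inj₂ (inj₁ (_ , _ , refl)) = ⊥-elim (irr (_ , ⊞⊗))
  ... | inj₂ (inj₂ (_ , _ , refl)) = ⊥-elim (irr (_ , •⊗))
  closed-irreducible-canonical (𝟎e [] d) irr
    with closed-irreducible-canonical d (Irreducible-inside ξδ𝟎 irr)
  ... | ()
  closed-irreducible-canonical (&e₁ [] d _) irr
    with closed-irreducible-canonical d (Irreducible-inside ξδ&₁ˡ irr)
  ... | _ , _ , refl = ⊥-elim (irr (_ , β&₁))
  closed-irreducible-canonical (&e₂ [] d _) irr
    with closed-irreducible-canonical d (Irreducible-inside ξδ&₂ˡ irr)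
  ... | _ , _ , refl = ⊥-elim (irr (_ , β&₂))
  closed-irreducible-canonical (⊕e [] d _ _) irr
    with closed-irreducible-canonical d (Irreducible-inside ξδ⊕₀ irr)
  ... | inj₁ (_ , refl)                       = ⊥-elim (irr (_ , β⊕₁))
  ... | inj₂ (inj₁ (_ , refl))                = ⊥-elim (irr (_ , β⊕₂))
  ... | inj₂ (inj₂ (inj₁ (_ , _ , refl)))     = ⊥-elim (irr (_ , ⊞⊕))
  ... | inj₂ (inj₂ (inj₂ (_ , _ , refl)))     = ⊥-elim (irr (_ , •⊕))
  closed-irreducible-canonical (!e [] d _) irr
    with closed-irreducible-canonical d (Irreducible-inside ξδ!ˡ irr)
  ... | _ , refl = ⊥-elim (irr (_ , β!))
  closed-irreducible-canonical (∀e d) irr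
    with closed-irreducible-canonical d (Irreducible-inside ξ·ᶠ irr)
  ... | _ , refl = ⊥-elim (irr (_ , β∀))

theorem4 : ∀ {c ℓ : Level} (S : Semiring c ℓ) →
    let open L2 S in
    let open Semiring S using (Carrier) in
    ∀ (A : Form) (t : Tm 0) → ClosedIrreducibleOf t A →
      ((X : ℕ) → A ≡ ` X → ⊥)
      × (A ≡ 1ᶠ → ∃ λ (a : Carrier) → t ≡ a ·⋆)
      × (∀ B C → A ≡ B ⊸ C → ∃ λ u → t ≡ ƛ B u)
      × (∀ B C → A ≡ B ⊗ C →
           (∃₂ λ u v → t ≡ u ⊗ₜ v) ⊎ (∃₂ λ u v → t ≡ u ⊞ v) ⊎ (∃₂ λ a u → t ≡ a • u))
      × (A ≡ ⊤ᶠ → t ≡ ⟨⟩)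
      × (A ≡ 0ᶠ → ⊥)
      × (∀ B C → A ≡ B & C → ∃₂ λ u v → t ≡ ⟨ u , v ⟩)
      × (∀ B C → A ≡ B ⊕ C →
           (∃ λ u → t ≡ inl u) ⊎ (∃ λ u → t ≡ inr u)
           ⊎ (∃₂ λ u v → t ≡ u ⊞ v) ⊎ (∃₂ λ a u → t ≡ a • u))
      × (∀ B → A ≡ ! B → ∃ λ u → t ≡ !ₜ u)
      × (∀ B → A ≡ ∀̇ B → ∃ λ u → t ≡ Λ u)
theorem4 S A t (d , irr) =
    (λ { _ refl → lower canonical })
  , (λ { refl → canonical })
  , (λ { _ _ refl → canonical })
  , (λ { _ _ refl → canonical })
  , (λ { refl → canonical })
  , (λ { refl → lower canonical })
  , (λ { _ _ refl → canonical })
  , (λ { _ _ refl → canonical })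
  , (λ { _ refl → canonical })
  , (λ { _ refl → canonical })
  where
    open CanonicalForms S
    canonical : Canonical A t
    canonical = closed-irreducible-canonical d irr
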